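{- Let $V$ be an $n$-dimensional vector space over $\mathbb{F}_q$, let $W$ be a subspace of $V$, let $T\in L(W,V)$ and let $\ell=\ell(T)$. Then the sequence $\lambda_T=(\lambda_1(T),\ldots,\lambda_\ell(T))$ is an integer partition of $n-d_\ell$, where $d_\ell=\dim W_\ell$.
   Context: $\mathbb{F}_q$ is the finite field with $q$ elements. $L(W,V)$ denotes the space of $\mathbb{F}_q$-linear maps $W\to V$. For $T\in L(W,V)$ define $W_0=V$, $W_1=W$, $W_{i+1}=\{v\in W_i: Tv\in W_i\}$ for $i\geq 1$; $d_i=\dim W_i$; $\ell(T)=\min\{i\geq 0: W_i=W_{i+1}\}$; and $\lambda_j(T)=d_{j-1}-d_j$ for $1\leq j\leq \ell(T)$. A partition of a nonnegative integer $m$ is a weakly decreasing sequence of positive integers summing to $m$ (the empty sequence is the partition of $0$). -}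

module Defs where

open import Level using (0ℓ)
open import Data.Nat using (ℕ; zero; suc; _<_; _∸_)
open import Data.Fin using (Fin)
import Data.Fin as Fin
open import Data.List using (List; map; upTo)
open import Data.Nat.ListAction using (sum)
open import Data.List.Relation.Unary.All using (All)
open import Data.List.Relation.Unary.Linked using (Linked)
open import Data.Product using (Σ; ∃; _×_; _,_)
open import Data.Unit using (⊤)
open import Relation.Nullary using (¬_)
open import Relation.Binary.PropositionalEquality using (_≡_; _≢_)
open import Algebra.Structures using (IsCommutativeRing)
open import Function.Bundles using (_↔_)
import Data.Nat as ℕ

record FiniteField (q : ℕ) : Set₁ where
  field
    Carrier : Set
    _+_ _*_ : Carrier → Carrier → Carrier
    -_      : Carrier → Carrier
    0# 1#   : Carrier
    isCommutativeRing : IsCommutativeRing _≡_ _+_ _*_ -_ 0# 1#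
    0≢1     : 0# ≢ 1#
    inverse : ∀ x → x ≢ 0# → Σ Carrier (λ y → x * y ≡ 1#)
    card    : Carrier ↔ Fin q

module LinAlg {q : ℕ} (F : FiniteField q) (n : ℕ) where
  open FiniteField F

  Vect : Set
  Vect = Fin n → Carrier

  zeroV : Vect
  zeroV = λ _ → 0#

  _+V_ : Vect → Vect → Vect
  (u +V v) i = u i + v i

  _·V_ : Carrier → Vect → Vect
  (a ·V v) i = a * v i

  _≋_ : Vect → Vect → Set
  u ≋ v = ∀ i → u i ≡ v i

  Pred : Set₁
  Pred = Vect → Set

  SameSet : Pred → Pred → Set
  SameSet A B = ∀ v → (A v → B v) × (B v → A v)

  record IsSubspace (P : Pred) : Set where
    field
      resp  : ∀ {u v} → u ≋ v → P u → P v
      zero∈ : P zeroV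
      +∈    : ∀ {u v} → P u → P v → P (u +V v)
      ·∈    : ∀ a {v} → P v → P (a ·V v)

  lincomb : ∀ {d} → (Fin d → Carrier) → (Fin d → Vect) → Vect
  lincomb {zero}  c b = zeroV
  lincomb {suc d} c b = (c Fin.zero ·V b Fin.zero) +V lincomb (λ i → c (Fin.suc i)) (λ i → b (Fin.suc i))

  IsDim : Pred → ℕ → Set
  IsDim P d = Σ (Fin d → Vect) λ b →
      (∀ i → P (b i))
    × (∀ (c : Fin d → Carrier) → lincomb c b ≋ zeroV → ∀ i → c i ≡ 0#)
    × (∀ v → P v → Σ (Fin d → Carrier) λ c → v ≋ lincomb c b)

  -- a linear map T ∈ L(W,V), W given by the predicate P
  record IsLinearMap (P : Pred) (T : (v : Vect) → P v → Vect) : Set where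
    field
      resp : ∀ {u v} (p : P u) (p' : P v) → u ≋ v → T u p ≋ T v p'
      +-hom : ∀ {u v} (p : P u) (p' : P v) (p'' : P (u +V v)) →
              T (u +V v) p'' ≋ (T u p +V T v p')
      ·-hom : ∀ a {v} (p : P v) (p' : P (a ·V v)) → T (a ·V v) p' ≋ (a ·V T v p)

  module Seq (P : Pred) (T : (v : Vect) → P v → Vect) where
    -- Wk k = W_{k+1};  toW k : W_{k+1} ⊆ W
    Wk  : ℕ → Pred
    toW : ∀ k {v} → Wk k v → P v
    Wk zero    v = P v
    Wk (suc k) v = Σ (Wk k v) λ p → Wk k (T v (toW k p))
    toW zero    p       = p
    toW (suc k) (p , _) = toW k p

    -- W_i:  W_0 = V, W_1 = W, W_{i+1} = {v ∈ W_i : T v ∈ W_i}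
    Wseq : ℕ → Pred
    Wseq zero    v = ⊤
    Wseq (suc k) v = Wk k v

    IsEll : ℕ → Set
    IsEll ℓ = SameSet (Wseq ℓ) (Wseq (suc ℓ))
            × (∀ i → i < ℓ → ¬ SameSet (Wseq i) (Wseq (suc i)))

IsPartition : ℕ → List ℕ → Set
IsPartition m xs = All (0 ℕ.<_) xs × Linked ℕ._≥_ xs × sum xs ≡ m

lambdaSeq : (ℕ → ℕ) → ℕ → List ℕ
lambdaSeq d ℓ = map (λ j → d j ∸ d (suc j)) (upTo ℓ)

-- The dimensions d_i = dim W_i of the chain V = W₀ ⊇ W₁ ⊇ W₂ ⊇ ⋯ decrease, strictly so
-- before ℓ since a subspace with the dimension of an enclosing subspace equals it, and the
-- parts λ_j = d_{j-1} − d_j telescope to d₀ − d_ℓ = n − d_ℓ. The parts decrease because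
-- v ∈ W_{i+1} lies in W_{i+2} exactly when T v ∈ W_{i+1}, so T induces an injection
-- W_{i+1}/W_{i+2} ↪ W_i/W_{i+1}. All dimension counts come from the Steinitz exchange lemma.

module Submission where

open import Defs
open import Level using (0ℓ)
open import Data.Nat as ℕ using (ℕ; zero; suc; _∸_; _≤_; _<_; _≥_; z≤n; s≤s; z<s)
import Data.Nat.Properties as ℕₚ
open import Data.Nat.Properties
  using (≤-refl; ≤-trans; ≤-antisym; <⇒≤; <⇒≱; ≰⇒>; m≤n⇒m≤1+n; m<n⇒0<n∸m;
         n∸n≡0; m∸n+n≡m; +-∸-assoc; m≤n+o⇒m∸n≤o; m+n≤o⇒m≤o∸n)
open import Data.Fin as Fin using (Fin; zero; suc; splitAt; _↑ˡ_; _↑ʳ_; punchIn)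
open import Data.Fin.Properties using (any?; all?; ¬∀⟶∃¬; suc-injective; splitAt⁻¹-↑ˡ; splitAt⁻¹-↑ʳ)
open import Data.Vec.Functional using (Vector; tail; _++_; insertAt)
open import Data.Vec.Functional.Properties using (lookup-++ˡ; lookup-++ʳ; insertAt-lookup; insertAt-punchIn)
open import Data.Sum using (inj₁; inj₂)
open import Data.Sum.Properties using ([,]-map)
open import Data.Empty using (⊥-elim)
open import Data.Unit using (⊤; tt)
open import Data.Product using (Σ; ∃; _×_; _,_; proj₁; proj₂)
open import Algebra.Bundles using (CommutativeRing)
import Algebra.Properties.CommutativeSemigroup as CommutativeSemigroupProperties
import Algebra.Properties.Semiring.Sum as SumProperties
import Algebra.Properties.Ring as RingProperties
import Algebra.Properties.Group as GroupProperties
open import Function using (id; _∘_; _$_; Inverse)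
open import Function.Properties.Inverse using (↔⇒↣)
open import Relation.Nullary using (Dec; yes; no; ¬_; map′)
open import Relation.Nullary.Decidable using (via-injection; decidable-stable)
open import Relation.Binary.Bundles using (Setoid)
open import Relation.Binary.Definitions using (DecidableEquality)
open import Relation.Binary.PropositionalEquality
  using (_≡_; _≢_; _≗_; refl; sym; trans; cong; cong₂; subst; _→-setoid_; module ≡-Reasoning)

tail-++ : ∀ {A : Set} {s r} (y : Vector A (suc s)) (a : Vector A r) → tail (y ++ a) ≗ tail y ++ a
tail-++ {s = s} y a i = [,]-map (splitAt s i)

↑ˡ-↑ʳ-elim : ∀ {s r} (Q : Fin (s ℕ.+ r) → Set) →
             (∀ i → Q (i ↑ˡ r)) → (∀ j → Q (s ↑ʳ j)) → ∀ i → Q i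
↑ˡ-↑ʳ-elim {s} Q Qˡ Qʳ i with splitAt s i in eq
... | inj₁ i′ = subst Q (splitAt⁻¹-↑ˡ eq) (Qˡ i′)
... | inj₂ j  = subst Q (splitAt⁻¹-↑ʳ eq) (Qʳ j)

∀-++ : ∀ {A : Set} {s r} (Q : A → Set) {y : Vector A s} {a : Vector A r} →
       (∀ i → Q (y i)) → (∀ j → Q (a j)) → ∀ i → Q ((y ++ a) i)
∀-++ Q {y} {a} Qy Qa =
  ↑ˡ-↑ʳ-elim (Q ∘ (y ++ a)) (λ i → subst Q (sym (lookup-++ˡ y a i)) (Qy i))
                            (λ j → subst Q (sym (lookup-++ʳ y a j)) (Qa j))

module Partitions where
  open import Data.List using (List; []; _∷_; applyUpTo)
  open import Data.List.Properties using (map-upTo)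
  open import Data.Nat.ListAction using (sum)
  open import Data.List.Relation.Unary.All using (All; []; _∷_)
  open import Data.List.Relation.Unary.Linked using (Linked; []; [-]; _∷_)

  differences : (ℕ → ℕ) → ℕ → List ℕ
  differences d ℓ = applyUpTo (λ j → d j ∸ d (suc j)) ℓ

  differences-positive : ∀ (d : ℕ → ℕ) ℓ → (∀ j → j < ℓ → d (suc j) < d j) →
                         All (0 <_) (differences d ℓ)
  differences-positive d zero    _ = []
  differences-positive d (suc ℓ) d↓ =
    m<n⇒0<n∸m (d↓ 0 z<s) ∷ differences-positive (d ∘ suc) ℓ (λ j j<ℓ → d↓ (suc j) (s≤s j<ℓ))

  differences-decreasing : ∀ (d : ℕ → ℕ) ℓ →
                           (∀ j → d (suc j) ∸ d (suc (suc j)) ≤ d j ∸ d (suc j)) →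
                           Linked _≥_ (differences d ℓ)
  differences-decreasing d zero          _ = []
  differences-decreasing d (suc zero)    _ = [-]
  differences-decreasing d (suc (suc ℓ)) concave =
    concave 0 ∷ differences-decreasing (d ∘ suc) (suc ℓ) (concave ∘ suc)

  antitone⇒≤ : ∀ (d : ℕ → ℕ) ℓ → (∀ j → j < ℓ → d (suc j) ≤ d j) → d ℓ ≤ d 0
  antitone⇒≤ d zero    _  = ≤-refl
  antitone⇒≤ d (suc ℓ) d↓ =
    ≤-trans (antitone⇒≤ (d ∘ suc) ℓ (λ j j<ℓ → d↓ (suc j) (s≤s j<ℓ))) (d↓ 0 z<s)

  ∸-+-∸ : ∀ {a b c} → c ≤ b → b ≤ a → (a ∸ b) ℕ.+ (b ∸ c) ≡ a ∸ c
  ∸-+-∸ {a} {b} {c} c≤b b≤a = begin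
    (a ∸ b) ℕ.+ (b ∸ c)  ≡⟨ +-∸-assoc (a ∸ b) c≤b ⟨
    (a ∸ b) ℕ.+ b ∸ c    ≡⟨ cong (_∸ c) (m∸n+n≡m b≤a) ⟩
    a ∸ c                ∎
    where open ≡-Reasoning

  sum-differences : ∀ (d : ℕ → ℕ) ℓ → (∀ j → j < ℓ → d (suc j) ≤ d j) →
                    sum (differences d ℓ) ≡ d 0 ∸ d ℓ
  sum-differences d zero    _  = sym (n∸n≡0 (d 0))
  sum-differences d (suc ℓ) d↓ = begin
    (d 0 ∸ d 1) ℕ.+ sum (differences (d ∘ suc) ℓ)
      ≡⟨ cong ((d 0 ∸ d 1) ℕ.+_) (sum-differences (d ∘ suc) ℓ d∘suc↓) ⟩
    (d 0 ∸ d 1) ℕ.+ (d 1 ∸ d (suc ℓ))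
      ≡⟨ ∸-+-∸ (antitone⇒≤ (d ∘ suc) ℓ d∘suc↓) (d↓ 0 z<s) ⟩
    d 0 ∸ d (suc ℓ)
      ∎
    where
    open ≡-Reasoning
    d∘suc↓ : ∀ j → j < ℓ → d (suc (suc j)) ≤ d (suc j)
    d∘suc↓ j j<ℓ = d↓ (suc j) (s≤s j<ℓ)

  lambdaSeq-isPartition : ∀ (d : ℕ → ℕ) ℓ → (∀ j → j < ℓ → d (suc j) < d j) →
                          (∀ j → d (suc j) ∸ d (suc (suc j)) ≤ d j ∸ d (suc j)) →
                          IsPartition (d 0 ∸ d ℓ) (lambdaSeq d ℓ)
  lambdaSeq-isPartition d ℓ d↓ concave = subst (IsPartition (d 0 ∸ d ℓ)) (sym (map-upTo _ ℓ))
    ( differences-positive d ℓ d↓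
    , differences-decreasing d ℓ concave
    , sum-differences d ℓ (λ j j<ℓ → <⇒≤ (d↓ j j<ℓ)))

open Partitions using (lambdaSeq-isPartition)

module FieldProperties {q : ℕ} (F : FiniteField q) where
  open FiniteField F using (Carrier; isCommutativeRing; card)

  commutativeRing : CommutativeRing 0ℓ 0ℓ
  commutativeRing = record { isCommutativeRing = isCommutativeRing }

  open CommutativeRing commutativeRing using (ring; +-group; +-commutativeSemigroup; semiring)
  open CommutativeRing commutativeRing public
    using (_+_; _*_; -_; 0#; 1#; +-assoc; +-comm; +-identityˡ; +-identityʳ; -‿inverseʳ;
           *-assoc; *-comm; *-identityˡ; *-identityʳ; zeroˡ; zeroʳ; distribˡ; distribʳ)
  open RingProperties ring public using (-‿distribˡ-*; -‿distribʳ-*; -1*x≈-x)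
  open CommutativeSemigroupProperties +-commutativeSemigroup public
    using () renaming (interchange to +-interchange; x∙yz≈y∙xz to +-leftComm)
  open SumProperties semiring public using (sum)
  open GroupProperties +-group using (inverseʳ-unique)
  open Inverse card using (to; from; strictlyInverseʳ)

  _≟_ : DecidableEquality Carrier
  _≟_ = via-injection (↔⇒↣ card) Fin._≟_

  ∃? : {Q : Carrier → Set} → (∀ a → Dec (Q a)) → Dec (∃ Q)
  ∃? {Q} Q? = map′ (λ (i , qi) → from i , qi)
                   (λ (a , qa) → to a , subst Q (sym (strictlyInverseʳ a)) qa)
                   (any? (Q? ∘ from))

  x+y≡0⇒x≡-1*y : ∀ {x y} → x + y ≡ 0# → x ≡ - 1# * y
  x+y≡0⇒x≡-1*y {x} {y} x+y≡0 = begin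
    x         ≡⟨ inverseʳ-unique y x (trans (+-comm y x) x+y≡0) ⟩
    - y       ≡⟨ -1*x≈-x y ⟨
    - 1# * y  ∎
    where open ≡-Reasoning

  x+-1*x≡0 : ∀ x → x + - 1# * x ≡ 0#
  x+-1*x≡0 x = trans (cong (x +_) (-1*x≈-x x)) (-‿inverseʳ x)

  x+[-xr]y≡0 : ∀ {x y r} → y * r ≡ 1# → x + - (x * r) * y ≡ 0#
  x+[-xr]y≡0 {x} {y} {r} yr≡1 = begin
    x + - (x * r) * y    ≡⟨ cong (x +_) (-‿distribˡ-* (x * r) y) ⟨
    x + - (x * r * y)    ≡⟨ cong (λ z → x + - z) (*-assoc x r y) ⟩
    x + - (x * (r * y))  ≡⟨ cong (λ z → x + - (x * z)) (trans (*-comm r y) yr≡1) ⟩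
    x + - (x * 1#)       ≡⟨ cong (λ z → x + - z) (*-identityʳ x) ⟩
    x + - x              ≡⟨ -‿inverseʳ x ⟩
    0#                   ∎
    where open ≡-Reasoning

  cx+y≡0⇒x≡-ry : ∀ {c x y r} → c * r ≡ 1# → c * x + y ≡ 0# → x ≡ (- r) * y
  cx+y≡0⇒x≡-ry {c} {x} {y} {r} cr≡1 cx+y≡0 = begin
    x                 ≡⟨ *-identityˡ x ⟨
    1# * x            ≡⟨ cong (_* x) (trans (*-comm r c) cr≡1) ⟨
    r * c * x         ≡⟨ *-assoc r c x ⟩
    r * (c * x)       ≡⟨ cong (r *_) (x+y≡0⇒x≡-1*y cx+y≡0) ⟩
    r * (- 1# * y)    ≡⟨ *-assoc r (- 1#) y ⟨
    r * - 1# * y      ≡⟨ cong (_* y) (-‿distribʳ-* r 1#) ⟨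
    - (r * 1#) * y    ≡⟨ cong (λ z → - z * y) (*-identityʳ r) ⟩
    - r * y           ∎
    where open ≡-Reasoning

module LinearAlgebra {q : ℕ} (F : FiniteField q) (n : ℕ) where
  open FiniteField F using (Carrier; 0≢1; inverse)
  open FieldProperties F
  open LinAlg F n
  open import Data.Vec.Functional using (_∷_)

  open Setoid (Fin n →-setoid Carrier) public
    using () renaming (refl to ≋-refl; sym to ≋-sym; trans to ≋-trans)

  IndependentModulo : Pred → ∀ {k} → (Fin k → Vect) → Set
  IndependentModulo S u = ∀ c → S (lincomb c u) → ∀ i → c i ≡ 0#

  Independent : ∀ {k} → (Fin k → Vect) → Set
  Independent = IndependentModulo (_≋ zeroV)

  InSpan : ∀ {k} → (Fin k → Vect) → Vect → Set
  InSpan u v = Σ (Fin _ → Carrier) λ c → v ≋ lincomb c u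

  lincomb-cong : ∀ {k} {c c′ : Fin k → Carrier} {u u′ : Fin k → Vect} →
                 (∀ i → c i ≡ c′ i) → (∀ i → u i ≋ u′ i) → lincomb c u ≋ lincomb c′ u′
  lincomb-cong {zero}  c≡c′ u≋u′ x = refl
  lincomb-cong {suc k} c≡c′ u≋u′ x =
    cong₂ _+_ (cong₂ _*_ (c≡c′ zero) (u≋u′ zero x)) (lincomb-cong (c≡c′ ∘ suc) (u≋u′ ∘ suc) x)

  lincomb-zeroˡ : ∀ {k} (u : Fin k → Vect) → lincomb (λ _ → 0#) u ≋ zeroV
  lincomb-zeroˡ {zero}  u x = refl
  lincomb-zeroˡ {suc k} u x = trans (cong₂ _+_ (zeroˡ (u zero x)) (lincomb-zeroˡ (tail u) x)) (+-identityʳ 0#)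

  lincomb-zeroʳ : ∀ {k} (c : Fin k → Carrier) {u : Fin k → Vect} {x} →
                  (∀ i → u i x ≡ 0#) → lincomb c u x ≡ 0#
  lincomb-zeroʳ {zero}  c u≡0 = refl
  lincomb-zeroʳ {suc k} c u≡0 =
    trans (cong₂ _+_ (trans (cong (c zero *_) (u≡0 zero)) (zeroʳ (c zero))) (lincomb-zeroʳ (tail c) (u≡0 ∘ suc)))
          (+-identityʳ 0#)

  lincomb-single : ∀ {k} (c : Fin k → Carrier) (u : Fin k → Vect) i {x} →
                   (∀ j → j ≢ i → u j x ≡ 0#) → lincomb c u x ≡ c i * u i x
  lincomb-single c u zero    u≡0 =
    trans (cong (c zero * u zero _ +_) (lincomb-zeroʳ (tail c) λ j → u≡0 (suc j) λ ())) (+-identityʳ _)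
  lincomb-single c u (suc i) u≡0 =
    trans (cong (_+ lincomb (tail c) (tail u) _) (trans (cong (c zero *_) (u≡0 zero λ ())) (zeroʳ (c zero))))
          (trans (+-identityˡ _)
                 (lincomb-single (tail c) (tail u) i λ j j≢i → u≡0 (suc j) (j≢i ∘ suc-injective)))

  lincomb-+ˡ : ∀ {k} (c c′ : Fin k → Carrier) (u : Fin k → Vect) →
               lincomb (λ i → c i + c′ i) u ≋ (lincomb c u +V lincomb c′ u)
  lincomb-+ˡ {zero}  c c′ u x = sym (+-identityʳ 0#)
  lincomb-+ˡ {suc k} c c′ u x =
    trans (cong₂ _+_ (distribʳ (u zero x) (c zero) (c′ zero)) (lincomb-+ˡ (tail c) (tail c′) (tail u) x))
          (+-interchange _ _ _ _)

  lincomb-+ʳ : ∀ {k} (c : Fin k → Carrier) (u u′ : Fin k → Vect) →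
               lincomb c (λ i → u i +V u′ i) ≋ (lincomb c u +V lincomb c u′)
  lincomb-+ʳ {zero}  c u u′ x = sym (+-identityʳ 0#)
  lincomb-+ʳ {suc k} c u u′ x =
    trans (cong₂ _+_ (distribˡ (c zero) (u zero x) (u′ zero x)) (lincomb-+ʳ (tail c) (tail u) (tail u′) x))
          (+-interchange _ _ _ _)

  lincomb-· : ∀ {k} (a : Carrier) (c : Fin k → Carrier) (u : Fin k → Vect) →
              lincomb (λ i → a * c i) u ≋ (a ·V lincomb c u)
  lincomb-· {zero}  a c u x = sym (zeroʳ a)
  lincomb-· {suc k} a c u x =
    trans (cong₂ _+_ (*-assoc a (c zero) (u zero x)) (lincomb-· a (tail c) (tail u) x))
          (sym (distribˡ a _ _))

  lincomb-scaled : ∀ {k} (c s : Fin k → Carrier) (v : Vect) →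
                   lincomb c (λ i → s i ·V v) ≋ (sum (λ i → c i * s i) ·V v)
  lincomb-scaled {zero}  c s v x = sym (zeroˡ (v x))
  lincomb-scaled {suc k} c s v x =
    trans (cong₂ _+_ (sym (*-assoc (c zero) (s zero) (v x))) (lincomb-scaled (tail c) (tail s) v x))
          (sym (distribʳ (v x) _ _))

  lincomb-tail : ∀ {k} (c : Fin (suc k) → Carrier) (u : Fin (suc k) → Vect) →
                 c zero ≡ 0# → lincomb c u ≋ lincomb (tail c) (tail u)
  lincomb-tail c u c₀≡0 x =
    trans (cong (_+ lincomb (tail c) (tail u) x) (trans (cong (_* u zero x) c₀≡0) (zeroˡ (u zero x))))
          (+-identityˡ _)

  lincomb-punchIn : ∀ {k} (c : Fin (suc k) → Carrier) (u : Fin (suc k) → Vect) (p : Fin (suc k)) →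
                    lincomb c u ≋ ((c p ·V u p) +V lincomb (c ∘ punchIn p) (u ∘ punchIn p))
  lincomb-punchIn         c u zero    x = refl
  lincomb-punchIn {suc k} c u (suc p) x =
    trans (cong (c zero * u zero x +_) (lincomb-punchIn (tail c) (tail u) p x)) (+-leftComm _ _ _)

  lincomb-++ : ∀ {s r} (c : Fin (s ℕ.+ r) → Carrier) (y : Fin s → Vect) (a : Fin r → Vect) →
               lincomb c (y ++ a) ≋ (lincomb (c ∘ (_↑ˡ r)) y +V lincomb (c ∘ (s ↑ʳ_)) a)
  lincomb-++ {zero}  c y a x = sym (+-identityˡ _)
  lincomb-++ {suc s} {r} c y a x = begin
    c zero * y zero x + lincomb (tail c) (tail (y ++ a)) x
      ≡⟨ cong (c zero * y zero x +_) (lincomb-cong (λ _ → refl) (λ i x → cong (_$ x) (tail-++ y a i)) x) ⟩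
    c zero * y zero x + lincomb (tail c) (tail y ++ a) x
      ≡⟨ cong (c zero * y zero x +_) (lincomb-++ (tail c) (tail y) a x) ⟩
    c zero * y zero x + (lincomb (tail c ∘ (_↑ˡ r)) (tail y) x + lincomb (tail c ∘ (s ↑ʳ_)) a x)
      ≡⟨ +-assoc _ _ _ ⟨
    c zero * y zero x + lincomb (tail c ∘ (_↑ˡ r)) (tail y) x + lincomb (tail c ∘ (s ↑ʳ_)) a x
      ∎
    where open ≡-Reasoning

  lincomb-∈ : ∀ {S} → IsSubspace S → ∀ {k} (c : Fin k → Carrier) {u : Fin k → Vect} →
              (∀ i → S (u i)) → S (lincomb c u)
  lincomb-∈ S-sub {zero}  c u∈S = IsSubspace.zero∈ S-sub
  lincomb-∈ S-sub {suc k} c u∈S =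
    IsSubspace.+∈ S-sub (IsSubspace.·∈ S-sub (c zero) (u∈S zero)) (lincomb-∈ S-sub (tail c) (u∈S ∘ suc))

  InSpan⇒∈ : ∀ {S} → IsSubspace S → ∀ {k} {u : Fin k → Vect} → (∀ i → S (u i)) →
             ∀ {v} → InSpan u v → S v
  InSpan⇒∈ S-sub u∈S (c , v≋cu) = IsSubspace.resp S-sub (≋-sym v≋cu) (lincomb-∈ S-sub c u∈S)

  InSpan-isSubspace : ∀ {k} (u : Fin k → Vect) → IsSubspace (InSpan u)
  InSpan-isSubspace u = record
    { resp  = λ { v≋w (c , v≋cu) → c , ≋-trans (≋-sym v≋w) v≋cu }
    ; zero∈ = (λ _ → 0#) , ≋-sym (lincomb-zeroˡ u)
    ; +∈    = λ { (c , v≋cu) (c′ , w≋c′u) → (λ i → c i + c′ i) , λ x →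
                trans (cong₂ _+_ (v≋cu x) (w≋c′u x)) (sym (lincomb-+ˡ c c′ u x)) }
    ; ·∈    = λ { a (c , v≋cu) → (λ i → a * c i) , λ x →
                trans (cong (a *_) (v≋cu x)) (sym (lincomb-· a c u x)) }
    }

  Independent-cong : ∀ {k} {u u′ : Fin k → Vect} → (∀ i → u i ≋ u′ i) → Independent u → Independent u′
  Independent-cong u≋u′ u-ind c cu′≋0 = u-ind c (≋-trans (lincomb-cong (λ _ → refl) u≋u′) cu′≋0)

  InSpan-cong : ∀ {k} {u u′ : Fin k → Vect} {v} → (∀ i → u i ≋ u′ i) → InSpan u v → InSpan u′ v
  InSpan-cong u≋u′ (c , v≋cu) = c , ≋-trans v≋cu (lincomb-cong (λ _ → refl) u≋u′)

  InSpan-head : ∀ {k} {v} (u : Fin k → Vect) → InSpan (v ∷ u) v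
  InSpan-head {v = v} u = (1# ∷ λ _ → 0#) , λ x →
    sym (trans (cong₂ _+_ (*-identityˡ (v x)) (lincomb-zeroˡ u x)) (+-identityʳ (v x)))

  InSpan-∷ : ∀ {k} {u : Fin k → Vect} {v} w → InSpan u v → InSpan (w ∷ u) v
  InSpan-∷ {u = u} w (c , v≋cu) = (0# ∷ c) , λ x →
    trans (v≋cu x) (sym (trans (cong (_+ lincomb c u x) (zeroˡ (w x))) (+-identityˡ _)))

  InSpan-tail : ∀ {k} {u : Fin (suc k) → Vect} {v} ((c , _) : InSpan u v) → c zero ≡ 0# → InSpan (tail u) v
  InSpan-tail {u = u} (c , v≋cu) c₀≡0 = tail c , ≋-trans v≋cu (lincomb-tail c u c₀≡0)

  ∃-lincomb? : ∀ {k} (u : Fin k → Vect) {R : Pred} → (∀ v → Dec (R v)) →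
               Dec (Σ (Fin k → Carrier) λ c → R (lincomb c u))
  ∃-lincomb? {zero}  u R? = map′ (λ r → (λ ()) , r) proj₂ (R? zeroV)
  ∃-lincomb? {suc k} u R? =
    map′ (λ (a , c , r) → a ∷ c , r) (λ (c , r) → c zero , tail c , r)
         (∃? λ a → ∃-lincomb? (tail u) λ v → R? ((a ·V u zero) +V v))

  InSpan? : ∀ {k} (u : Fin k → Vect) v → Dec (InSpan u v)
  InSpan? u v = ∃-lincomb? u λ w → all? λ i → v i ≟ w i

  independent-∷ : ∀ {k} {u : Fin k → Vect} {v} → Independent u → ¬ InSpan u v → Independent (v ∷ u)
  independent-∷ {u = u} {v} u-ind v∉ c cvu≋0 = λ { zero → c₀≡0 ; (suc i) → u-ind (tail c) cu≋0 i }
    where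
    c₀≡0 : c zero ≡ 0#
    c₀≡0 = decidable-stable (c zero ≟ 0#) λ c₀≢0 →
      let (r , c₀r≡1) = inverse (c zero) c₀≢0 in
      v∉ ( (λ i → (- r) * c (suc i))
         , λ x → trans (cx+y≡0⇒x≡-ry c₀r≡1 (cvu≋0 x)) (sym (lincomb-· (- r) (tail c) u x)))
    cu≋0 : lincomb (tail c) u ≋ zeroV
    cu≋0 = ≋-trans (≋-sym (lincomb-tail c (v ∷ u) c₀≡0)) cvu≋0

  independent-shear : ∀ {m} {u : Fin (suc m) → Vect} → Independent u → ∀ p (s : Fin m → Carrier) →
                      Independent (λ j → u (punchIn p j) +V (s j ·V u p))
  independent-shear {u = u} u-ind p s d du′≋0 j =
    trans (sym (insertAt-punchIn d p σ j)) (u-ind e eu≋0 (punchIn p j))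
    where
    σ : Carrier
    σ = sum λ j → d j * s j
    e : Fin _ → Carrier
    e = insertAt d p σ
    eu≋0 : lincomb e u ≋ zeroV
    eu≋0 x = begin
      lincomb e u x
        ≡⟨ lincomb-punchIn e u p x ⟩
      e p * u p x + lincomb (e ∘ punchIn p) (u ∘ punchIn p) x
        ≡⟨ cong₂ _+_ (cong (_* u p x) (insertAt-lookup d p σ))
                     (lincomb-cong (insertAt-punchIn d p σ) (λ _ → ≋-refl) x) ⟩
      σ * u p x + lincomb d (u ∘ punchIn p) x
        ≡⟨ +-comm _ _ ⟩
      lincomb d (u ∘ punchIn p) x + σ * u p x
        ≡⟨ cong (lincomb d (u ∘ punchIn p) x +_) (lincomb-scaled d s (u p) x) ⟨
      lincomb d (u ∘ punchIn p) x + lincomb d (λ j → s j ·V u p) x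
        ≡⟨ lincomb-+ʳ d _ _ x ⟨
      lincomb d (λ j → u (punchIn p j) +V (s j ·V u p)) x
        ≡⟨ du′≋0 x ⟩
      0#
        ∎
      where open ≡-Reasoning

  steinitz : ∀ {m k} (u : Fin m → Vect) (w : Fin k → Vect) →
             Independent u → (∀ i → InSpan w (u i)) → m ≤ k
  steinitz {zero}          _ _ _     _  = z≤n
  steinitz {suc m} {zero}  u w u-ind u∈ =
    ⊥-elim (0≢1 (sym (u-ind (λ _ → 1#) (λ x → lincomb-zeroʳ (λ _ → 1#) {u} λ i → proj₂ (u∈ i) x) zero)))
  steinitz {suc m} {suc k} u w u-ind u∈ with all? (λ i → proj₁ (u∈ i) zero ≟ 0#)
  ... | yes c₀≡0 = m≤n⇒m≤1+n (steinitz u (tail w) u-ind λ i → InSpan-tail {u = w} (u∈ i) (c₀≡0 i))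
  ... | no  c₀≢0 = s≤s (steinitz u′ (tail w) (independent-shear {u = u} u-ind p s) u′∈)
    where
    open IsSubspace (InSpan-isSubspace w)
    C : Fin (suc m) → Fin (suc k) → Carrier
    C i = proj₁ (u∈ i)
    pivot : ∃ λ p → C p zero ≢ 0#
    pivot = ¬∀⟶∃¬ _ _ (λ i → C i zero ≟ 0#) c₀≢0
    p : Fin (suc m)
    p = proj₁ pivot
    r : Carrier
    r = proj₁ (inverse (C p zero) (proj₂ pivot))
    Cₚr≡1 : C p zero * r ≡ 1#
    Cₚr≡1 = proj₂ (inverse (C p zero) (proj₂ pivot))
    -- s j clears the w₀-coordinate of u (punchIn p j).
    s : Fin m → Carrier
    s j = - (C (punchIn p j) zero * r)
    u′ : Fin m → Vect
    u′ j = u (punchIn p j) +V (s j ·V u p)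
    u′∈ : ∀ j → InSpan (tail w) (u′ j)
    u′∈ j = InSpan-tail {u = w} (+∈ (u∈ (punchIn p j)) (·∈ (s j) (u∈ p))) (x+[-xr]y≡0 Cₚr≡1)

  ∷-++ : ∀ {s r} (v : Vect) (y : Fin s → Vect) (a : Fin r → Vect) →
         ∀ i → ((v ∷ y) ++ a) i ≋ (v ∷ (y ++ a)) i
  ∷-++ v y a zero    = ≋-refl
  ∷-++ v y a (suc i) = λ x → cong (_$ x) (tail-++ (v ∷ y) a i)

  extend : ∀ {r k} {Q : Pred} (a : Fin r → Vect) (w : Fin k → Vect) → Independent a → (∀ j → Q (w j)) →
           Σ ℕ λ s → Σ (Fin s → Vect) λ y →
           (∀ i → Q (y i)) × Independent (y ++ a) × (∀ j → InSpan (y ++ a) (w j))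
  extend {k = zero}  a w a-ind _ = 0 , (λ ()) , (λ ()) , a-ind , (λ ())
  extend {k = suc k} {Q} a w a-ind w∈Q with extend {Q = Q} a (tail w) a-ind (w∈Q ∘ suc)
  ... | s , y , y∈Q , ya-ind , w∈span with InSpan? (y ++ a) (w zero)
  ...   | yes w₀∈span = s , y , y∈Q , ya-ind , λ { zero → w₀∈span ; (suc j) → w∈span j }
  ...   | no  w₀∉span =
    suc s , w zero ∷ y , (λ { zero → w∈Q zero ; (suc i) → y∈Q i }) ,
    Independent-cong (≋-sym ∘ ∷-++ (w zero) y a) (independent-∷ ya-ind w₀∉span) ,
    λ { zero → InSpan-cong (≋-sym ∘ ∷-++ (w zero) y a) (InSpan-head (y ++ a))
      ; (suc j) → InSpan-cong (≋-sym ∘ ∷-++ (w zero) y a) (InSpan-∷ (w zero) (w∈span j)) }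

  standardBasis : Fin n → Vect
  standardBasis i j with i Fin.≟ j
  ... | yes _ = 1#
  ... | no  _ = 0#

  standardBasis-diag : ∀ i → standardBasis i i ≡ 1#
  standardBasis-diag i with i Fin.≟ i
  ... | yes _   = refl
  ... | no  i≢i = ⊥-elim (i≢i refl)

  standardBasis-off : ∀ {i j} → i ≢ j → standardBasis i j ≡ 0#
  standardBasis-off {i} {j} i≢j with i Fin.≟ j
  ... | yes i≡j = ⊥-elim (i≢j i≡j)
  ... | no  _   = refl

  lincomb-standardBasis : ∀ c → lincomb c standardBasis ≋ c
  lincomb-standardBasis c x = begin
    lincomb c standardBasis x     ≡⟨ lincomb-single c standardBasis x (λ _ → standardBasis-off) ⟩
    c x * standardBasis x x       ≡⟨ cong (c x *_) (standardBasis-diag x) ⟩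
    c x * 1#                      ≡⟨ *-identityʳ (c x) ⟩
    c x                           ∎
    where open ≡-Reasoning

  standardBasis-isDim : IsDim (λ _ → ⊤) n
  standardBasis-isDim =
      standardBasis
    , (λ _ → tt)
    , (λ c c·e≋0 i → trans (sym (lincomb-standardBasis c i)) (c·e≋0 i))
    , (λ v _ → v , ≋-sym (lincomb-standardBasis v))

  independent-≤-dim : ∀ {B b m} {u : Fin m → Vect} → IsDim B b → Independent u → (∀ i → B (u i)) → m ≤ b
  independent-≤-dim (e , _ , _ , e-spans) u-ind u∈B = steinitz _ e u-ind λ i → e-spans _ (u∈B i)

  dim-mono : ∀ {A B a b} → (∀ {v} → A v → B v) → IsDim A a → IsDim B b → a ≤ b
  dim-mono A⊆B (e , e∈A , e-ind , _) B-dim = independent-≤-dim B-dim e-ind (A⊆B ∘ e∈A)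

  dim-⊤ : ∀ {d} → IsDim (λ _ → ⊤) d → d ≡ n
  dim-⊤ d-dim = ≤-antisym (dim-mono id d-dim standardBasis-isDim) (dim-mono id standardBasis-isDim d-dim)

  dim-≤⇒⊇ : ∀ {A B a b} → IsSubspace A → (∀ {v} → A v → B v) → IsDim A a → IsDim B b → b ≤ a →
            ∀ {v} → B v → A v
  dim-≤⇒⊇ {B = B} A-sub A⊆B (e , e∈A , e-ind , _) B-dim b≤a {v} v∈B with InSpan? e v
  ... | yes v∈span = InSpan⇒∈ A-sub e∈A v∈span
  ... | no  v∉span = ⊥-elim (<⇒≱ (independent-≤-dim B-dim (independent-∷ e-ind v∉span) ev∈B) b≤a)
    where
    ev∈B : ∀ i → B ((v ∷ e) i)
    ev∈B zero    = v∈B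
    ev∈B (suc i) = A⊆B (e∈A i)

  independentModulo-++ : ∀ {S s r} {z : Fin s → Vect} {b : Fin r → Vect} → IsSubspace S →
                         IndependentModulo S z → Independent b → (∀ j → S (b j)) → Independent (z ++ b)
  independentModulo-++ {s = s} {r} {z} {b} S-sub z-ind b-ind b∈S c c·zb≋0 =
    ↑ˡ-↑ʳ-elim (λ i → c i ≡ 0#) γ≡0 β≡0
    where
    γ : Fin s → Carrier
    γ = c ∘ (_↑ˡ r)
    β : Fin r → Carrier
    β = c ∘ (s ↑ʳ_)
    γz+βb≋0 : (lincomb γ z +V lincomb β b) ≋ zeroV
    γz+βb≋0 = ≋-trans (≋-sym (lincomb-++ c z b)) c·zb≋0
    γ≡0 : ∀ i → γ i ≡ 0#
    γ≡0 = z-ind γ (IsSubspace.resp S-sub (λ x → sym (x+y≡0⇒x≡-1*y (γz+βb≋0 x)))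
                                         (IsSubspace.·∈ S-sub (- 1#) (lincomb-∈ S-sub β b∈S)))
    γz≋0 : lincomb γ z ≋ zeroV
    γz≋0 = ≋-trans (lincomb-cong γ≡0 (λ _ → ≋-refl)) (lincomb-zeroˡ z)
    βb≋0 : lincomb β b ≋ zeroV
    βb≋0 x = begin
      lincomb β b x                  ≡⟨ +-identityˡ _ ⟨
      0# + lincomb β b x             ≡⟨ cong (_+ lincomb β b x) (γz≋0 x) ⟨
      lincomb γ z x + lincomb β b x  ≡⟨ γz+βb≋0 x ⟩
      0#                             ∎
      where open ≡-Reasoning
    β≡0 : ∀ j → β j ≡ 0#
    β≡0 = b-ind β βb≋0

  independent-++⇒independentModulo : ∀ {S s r} {y : Fin s → Vect} {a : Fin r → Vect} →
                                     Independent (y ++ a) → (∀ {v} → S v → InSpan a v) → IndependentModulo S y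
  independent-++⇒independentModulo {s = s} {r} {y} {a} ya-ind a-spans γ γy∈S i =
    trans (sym (lookup-++ˡ γ α′ i)) (ya-ind (γ ++ α′) γα′·ya≋0 (i ↑ˡ r))
    where
    α : Fin r → Carrier
    α = proj₁ (a-spans γy∈S)
    α′ : Fin r → Carrier
    α′ j = - 1# * α j
    γα′·ya≋0 : lincomb (γ ++ α′) (y ++ a) ≋ zeroV
    γα′·ya≋0 x = begin
      lincomb (γ ++ α′) (y ++ a) x
        ≡⟨ lincomb-++ (γ ++ α′) y a x ⟩
      lincomb ((γ ++ α′) ∘ (_↑ˡ r)) y x + lincomb ((γ ++ α′) ∘ (s ↑ʳ_)) a x
        ≡⟨ cong₂ _+_ (lincomb-cong (lookup-++ˡ γ α′) (λ _ → ≋-refl) x)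
                     (lincomb-cong (lookup-++ʳ γ α′) (λ _ → ≋-refl) x) ⟩
      lincomb γ y x + lincomb α′ a x
        ≡⟨ cong (lincomb γ y x +_) (lincomb-· (- 1#) α a x) ⟩
      lincomb γ y x + - 1# * lincomb α a x
        ≡⟨ cong (λ t → lincomb γ y x + - 1# * t) (proj₂ (a-spans γy∈S) x) ⟨
      lincomb γ y x + - 1# * lincomb γ y x
        ≡⟨ x+-1*x≡0 _ ⟩
      0#
        ∎
      where open ≡-Reasoning

  module _ {P : Pred} (P-sub : IsSubspace P) {T : (v : Vect) → P v → Vect} (T-lin : IsLinearMap P T) where
    open IsLinearMap T-lin

    T-zero : ∀ {v} (p : P v) → v ≋ zeroV → T v p ≋ zeroV
    T-zero {v} p v≋0 x = begin
      T v p x                  ≡⟨ resp p 0·0∈P (λ y → trans (v≋0 y) (sym (zeroˡ 0#))) x ⟩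
      T (0# ·V zeroV) 0·0∈P x  ≡⟨ ·-hom 0# 0∈P 0·0∈P x ⟩
      0# * T zeroV 0∈P x       ≡⟨ zeroˡ _ ⟩
      0#                       ∎
      where
      open ≡-Reasoning
      0∈P : P zeroV
      0∈P = IsSubspace.zero∈ P-sub
      0·0∈P : P (0# ·V zeroV)
      0·0∈P = IsSubspace.·∈ P-sub 0# 0∈P

    T-lincomb : ∀ {k} (c : Fin k → Carrier) (y : Fin k → Vect) (y∈P : ∀ i → P (y i)) (p : P (lincomb c y)) →
                T (lincomb c y) p ≋ lincomb c (λ i → T (y i) (y∈P i))
    T-lincomb {zero}  c y y∈P p = T-zero p ≋-refl
    T-lincomb {suc k} c y y∈P p x =
      trans (+-hom c₀y₀∈P rest∈P p x)
            (cong₂ _+_ (·-hom (c zero) (y∈P zero) c₀y₀∈P x)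
                       (T-lincomb (tail c) (tail y) (y∈P ∘ suc) rest∈P x))
      where
      c₀y₀∈P : P (c zero ·V y zero)
      c₀y₀∈P = IsSubspace.·∈ P-sub (c zero) (y∈P zero)
      rest∈P : P (lincomb (tail c) (tail y))
      rest∈P = lincomb-∈ P-sub (tail c) (y∈P ∘ suc)

    independentModulo-image : ∀ {A A′ B′ s} {y : Fin s → Vect} → IsSubspace A → IsSubspace B′ →
                              (A⊆P : ∀ {v} → A v → P v) →
                              (∀ {v} (v∈A : A v) → B′ (T v (A⊆P v∈A)) → A′ v) →
                              (y∈A : ∀ i → A (y i)) → IndependentModulo A′ y →
                              IndependentModulo B′ (λ i → T (y i) (A⊆P (y∈A i)))
    independentModulo-image {A} {y = y} A-sub B′-sub A⊆P T⁻¹B′⊆A′ y∈A y-ind γ γTy∈B′ =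
      y-ind γ (T⁻¹B′⊆A′ γy∈A
                (IsSubspace.resp B′-sub (≋-sym (T-lincomb γ y (A⊆P ∘ y∈A) (A⊆P γy∈A))) γTy∈B′))
      where
      γy∈A : A (lincomb γ y)
      γy∈A = lincomb-∈ A-sub γ y∈A

    -- The hypotheses say that T induces an injective map A/A′ → B/B′.
    quotient-dim-≤ : ∀ {A A′ B B′ a a′ b b′} → IsSubspace A → IsSubspace B′ →
                     (A⊆P : ∀ {v} → A v → P v) → (∀ {v} → B′ v → B v) →
                     (∀ {v} (v∈A : A v) → B (T v (A⊆P v∈A))) →
                     (∀ {v} (v∈A : A v) → B′ (T v (A⊆P v∈A)) → A′ v) →
                     IsDim A a → IsDim A′ a′ → IsDim B b → IsDim B′ b′ → a ∸ a′ ≤ b ∸ b′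
    quotient-dim-≤ {A} {B = B} {B′} {a} {a′} {b} {b′} A-sub B′-sub A⊆P B′⊆B TA⊆B T⁻¹B′⊆A′
                   (e , e∈A , e-ind , _) (e′ , _ , e′-ind , e′-spans) B-dim (f′ , f′∈B′ , f′-ind , _)
      with extend {Q = A} e′ e e′-ind e∈A
    ... | s , y , y∈A , ye′-ind , e∈span =
      ≤-trans (m≤n+o⇒m∸n≤o a a′ a≤a′+s) (m+n≤o⇒m≤o∸n s s+b′≤b)
      where
      a≤a′+s : a ≤ a′ ℕ.+ s
      a≤a′+s = subst (a ≤_) (ℕₚ.+-comm s a′) (steinitz e (y ++ e′) e-ind e∈span)
      Ty : Fin s → Vect
      Ty i = T (y i) (A⊆P (y∈A i))
      Ty-ind : IndependentModulo B′ Ty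
      Ty-ind = independentModulo-image A-sub B′-sub A⊆P T⁻¹B′⊆A′ y∈A
                 (independent-++⇒independentModulo ye′-ind (e′-spans _))
      s+b′≤b : s ℕ.+ b′ ≤ b
      s+b′≤b = independent-≤-dim B-dim (independentModulo-++ B′-sub Ty-ind f′-ind f′∈B′)
                                 (∀-++ B (TA⊆B ∘ y∈A) (B′⊆B ∘ f′∈B′))

module Filtration {q : ℕ} (F : FiniteField q) (n : ℕ)
                  (P : LinAlg.Pred F n) (P-sub : LinAlg.IsSubspace F n P)
                  (T : (v : LinAlg.Vect F n) → P v → LinAlg.Vect F n) (T-lin : LinAlg.IsLinearMap F n P T) where
  open LinAlg F n
  open LinearAlgebra F n
  open Seq P T
  open IsLinearMap T-lin

  Wk-isSubspace : ∀ k → IsSubspace (Wk k)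
  Wk-isSubspace zero    = P-sub
  Wk-isSubspace (suc k) = record
    { resp  = λ { u≋v (u∈ , Tu∈) →
                W.resp u≋v u∈ , W.resp (resp (toW k u∈) (toW k (W.resp u≋v u∈)) u≋v) Tu∈ }
    ; zero∈ = W.zero∈ , W.resp (≋-sym (T-zero P-sub T-lin (toW k W.zero∈) ≋-refl)) W.zero∈
    ; +∈    = λ { (u∈ , Tu∈) (v∈ , Tv∈) →
                W.+∈ u∈ v∈ , W.resp (≋-sym (+-hom (toW k u∈) (toW k v∈) (toW k (W.+∈ u∈ v∈))))
                                    (W.+∈ Tu∈ Tv∈) }
    ; ·∈    = λ { a (v∈ , Tv∈) →
                W.·∈ a v∈ , W.resp (≋-sym (·-hom a (toW k v∈) (toW k (W.·∈ a v∈)))) (W.·∈ a Tv∈) }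
    }
    where module W = IsSubspace (Wk-isSubspace k)

  Wseq-isSubspace : ∀ i → IsSubspace (Wseq i)
  Wseq-isSubspace zero    = record { resp = λ _ _ → tt ; zero∈ = tt ; +∈ = λ _ _ → tt ; ·∈ = λ _ _ → tt }
  Wseq-isSubspace (suc i) = Wk-isSubspace i

  Wseq-suc⊆ : ∀ i {v} → Wseq (suc i) v → Wseq i v
  Wseq-suc⊆ zero    _        = tt
  Wseq-suc⊆ (suc i) (v∈ , _) = v∈

  T-Wseq : ∀ i {v} (v∈ : Wseq (suc i) v) → Wseq i (T v (toW i v∈))
  T-Wseq zero    _         = tt
  T-Wseq (suc i) (_ , Tv∈) = Tv∈

  module _ (d : ℕ → ℕ) (dims : ∀ i → IsDim (Wseq i) (d i)) where

    d-zero : d 0 ≡ n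
    d-zero = dim-⊤ (dims 0)

    d-suc-< : ∀ j → ¬ SameSet (Wseq j) (Wseq (suc j)) → d (suc j) < d j
    d-suc-< j Wⱼ≠Wⱼ₊₁ = ≰⇒> λ dⱼ≤dⱼ₊₁ → Wⱼ≠Wⱼ₊₁ λ v →
        dim-≤⇒⊇ (Wseq-isSubspace (suc j)) (Wseq-suc⊆ j) (dims (suc j)) (dims j) dⱼ≤dⱼ₊₁
      , Wseq-suc⊆ j

    -- v ∈ W_{j+2} is by definition the pair (v ∈ W_{j+1} , T v ∈ W_{j+1}).
    differences-concave : ∀ j → d (suc j) ∸ d (suc (suc j)) ≤ d j ∸ d (suc j)
    differences-concave j =
      quotient-dim-≤ P-sub T-lin (Wseq-isSubspace (suc j)) (Wseq-isSubspace (suc j))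
                     (toW j) (Wseq-suc⊆ j) (T-Wseq j) _,_
                     (dims (suc j)) (dims (suc (suc j))) (dims j) (dims (suc j))

mainTheorem2 : ∀ {q : ℕ} (F : FiniteField q) (n : ℕ)
                 → let open LinAlg F n in
                 (P : Pred) → IsSubspace P
                 → (T : (v : Vect) → P v → Vect) → IsLinearMap P T
                 → let open Seq P T in
                 (ℓ : ℕ) → IsEll ℓ
                 → (d : ℕ → ℕ) → (∀ i → IsDim (Wseq i) (d i))
                 → IsPartition (n ∸ d ℓ) (lambdaSeq d ℓ)
mainTheorem2 F n P P-sub T T-lin ℓ (_ , minimal) d dims =
  subst (λ m → IsPartition (m ∸ d ℓ) (lambdaSeq d ℓ)) (d-zero d dims)
        (lambdaSeq-isPartition d ℓ (λ j j<ℓ → d-suc-< d dims j (minimal j j<ℓ)) (differences-concave d dims))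
  where open Filtration F n P P-sub T T-lin
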